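{- The number $c_m(n)$ of monotone paths of length $n$ in a strip of height $m$ equals the number of walks of length $n$ in the transfer graph $G_m$ that start at vertex $(0,0)$.
   Context: For an integer $m\ge 1$, the strip of height $m$ is $\{(x,y)\in\mathbb{Z}^2 : x\ge 0,\ 0\le y\le m\}$. A monotone path of length $n$ in the strip of height $m$ is a lattice path that starts at $(0,0)$, takes $n$ steps, each equal to $N=(0,1)$, $S=(0,-1)$ or $E=(1,0)$, never retraces steps (no $N$ immediately followed by $S$ and no $S$ immediately by $N$), and stays within the strip; $c_m(n)$ is their number. The transfer graph $G_m$ is the directed graph whose vertices are the pairs $(i,j)$ with $i,j\in\{0,\dots,m\}$ and $j\in\{i-1,i,i+1\}$, with an edge $(i,j)\to(j,k)$ for all such vertices $(i,j),(j,k)$ unless $j=i\pm1$ and $k=i$ (loops such as $(i,i)\to(i,i)$ are allowed). -}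

module Defs where

open import Data.Nat using (ℕ; zero; suc; _+_; _≡ᵇ_; _≤ᵇ_)
open import Data.Bool using (Bool; true; false; _∧_; _∨_; not)
open import Data.List using (List; []; _∷_; map; concatMap; length; filterᵇ; upTo)
open import Data.Product using (_×_; _,_)

seqs : {A : Set} → List A → ℕ → List (List A)
seqs xs zero    = [] ∷ []
seqs xs (suc n) = concatMap (λ x → map (x ∷_) (seqs xs n)) xs

data Step : Set where
  N S E : Step

allSteps : List Step
allSteps = N ∷ S ∷ E ∷ []

retract : Step → Step → Bool
retract N S = true
retract S N = true
retract _ _ = false

-- validFrom m y prev w : the step word w, executed from height y
-- (previous step prev, if any), never retraces and stays with 0 ≤ y ≤ m.
-- (The x-coordinate never decreases, so x ≥ 0 is automatic.)
data Prev : Set where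
  none : Prev
  some : Step → Prev

notRetract : Prev → Step → Bool
notRetract none     s = true
notRetract (some p) s = not (retract p s)

validFrom : ℕ → ℕ → Prev → List Step → Bool
validFrom m y p []            = true
validFrom m y p (N ∷ w)       = notRetract p N ∧ (suc y ≤ᵇ m) ∧ validFrom m (suc y) (some N) w
validFrom m zero p (S ∷ w)    = false
validFrom m (suc y) p (S ∷ w) = notRetract p S ∧ validFrom m y (some S) w
validFrom m y p (E ∷ w)       = validFrom m y (some E) w

isMonotonePath : ℕ → List Step → Bool
isMonotonePath m w = validFrom m 0 none w

c : ℕ → ℕ → ℕ
c m n = length (filterᵇ (isMonotonePath m) (seqs allSteps n))

near : ℕ → ℕ → Bool
near i j = (i ≡ᵇ j) ∨ (suc i ≡ᵇ j) ∨ (suc j ≡ᵇ i)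

adjacent : ℕ → ℕ → Bool
adjacent i j = (suc i ≡ᵇ j) ∨ (suc j ≡ᵇ i)

vertices : ℕ → List (ℕ × ℕ)
vertices m = filterᵇ (λ { (i , j) → near i j })
  (concatMap (λ i → map (i ,_) (upTo (suc m))) (upTo (suc m)))

edge : ℕ × ℕ → ℕ × ℕ → Bool
edge (i , j) (j' , k) = (j ≡ᵇ j') ∧ not (adjacent i j ∧ (k ≡ᵇ i))

walkFrom : ℕ × ℕ → List (ℕ × ℕ) → Bool
walkFrom v []       = true
walkFrom v (u ∷ us) = edge v u ∧ walkFrom u us

walks : ℕ → ℕ → ℕ
walks m n = length (filterᵇ (walkFrom (0 , 0)) (seqs (vertices m) n))

{-# OPTIONS --safe #-}
-- A monotone path that reached its current height y by a last step from height a sits at the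
-- vertex (a , y) of G_m (a = y after an E step, and at the start). It may continue to any height
-- k ∈ {y - 1, y, y + 1} of the strip except back to a after a vertical step, and this forbidden
-- continuation is exactly the missing edge (a , y) → (y , a). So the numbers of continuations of
-- length n of the path and of walks of length n from (a , y) satisfy the same recurrence in n,
-- starting from 1 at n = 0.

module Submission where

open import Defs
open import Data.Nat using (ℕ; _≥_)
open import Relation.Binary.PropositionalEquality using (_≡_)

open import Algebra.Properties.CommutativeSemigroup using (interchange)
open import Data.Bool using (Bool; true; false; _∧_; _∨_; not; if_then_else_; T)
open import Data.Bool.Properties using (T-≡; ∧-zeroʳ; ∨-zeroʳ; if-∧; if-swap-then; if-cong; if-cong-then)
open import Data.List using (List; []; _∷_; _++_; map; concatMap; length; filterᵇ; upTo)
open import Data.List.Properties using (map-cong; map-∘; map-++; map-applyUpTo)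
open import Data.Nat using (zero; suc; _+_; _≡ᵇ_; _<ᵇ_; _≤_; _<_; _≟_; z≤n; s≤s)
open import Data.Nat.ListAction using (sum)
open import Data.Nat.ListAction.Properties using (sum-++)
open import Data.Nat.Properties
  using (+-identityʳ; +-commutativeSemigroup; <ᵇ⇒<; <⇒<ᵇ; <⇒≤; m≤n⇒m≤1+n; n≤1+n; <⇒≢; >⇒≢)
open import Data.Product using (_×_; _,_)
open import Function using (_∘_; Equivalence)
open import Relation.Binary.PropositionalEquality using (_≢_; refl; sym; trans; cong; cong₂; module ≡-Reasoning)
open import Relation.Nullary using (yes; no)
open import Relation.Nullary.Decidable using (dec-true; dec-false)

open ≡-Reasoning

private
  variable
    A B : Set

∑ : List A → (A → ℕ) → ℕ
∑ xs f = sum (map f xs)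

syntax ∑ xs (λ x → f) = ∑[ x ∈ xs ] f

∑-cong : ∀ (xs : List A) {f g : A → ℕ} → (∀ x → f x ≡ g x) → ∑ xs f ≡ ∑ xs g
∑-cong xs f≗g = cong sum (map-cong f≗g xs)

∑-map : ∀ (h : A → B) xs (f : B → ℕ) → ∑ (map h xs) f ≡ ∑[ x ∈ xs ] f (h x)
∑-map h xs f = cong sum (sym (map-∘ xs))

∑-++ : ∀ xs ys (f : A → ℕ) → ∑ (xs ++ ys) f ≡ ∑ xs f + ∑ ys f
∑-++ xs ys f = trans (cong sum (map-++ f xs ys)) (sum-++ (map f xs) (map f ys))

∑-concatMap : ∀ (g : A → List B) xs (f : B → ℕ) → ∑ (concatMap g xs) f ≡ ∑[ x ∈ xs ] ∑ (g x) f
∑-concatMap g []       f = refl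
∑-concatMap g (x ∷ xs) f =
  trans (∑-++ (g x) (concatMap g xs) f) (cong (∑ (g x) f +_) (∑-concatMap g xs f))

∑-filterᵇ : ∀ (p : A → Bool) xs (f : A → ℕ) →
  ∑ (filterᵇ p xs) f ≡ ∑[ x ∈ xs ] (if p x then f x else 0)
∑-filterᵇ p []       f = refl
∑-filterᵇ p (x ∷ xs) f with p x
... | true  = cong (f x +_) (∑-filterᵇ p xs f)
... | false = ∑-filterᵇ p xs f

∑-+ : ∀ xs (f g : A → ℕ) → ∑[ x ∈ xs ] (f x + g x) ≡ ∑ xs f + ∑ xs g
∑-+ []       f g = refl
∑-+ (x ∷ xs) f g = trans (cong (f x + g x +_) (∑-+ xs f g))
                         (interchange +-commutativeSemigroup (f x) (g x) (∑ xs f) (∑ xs g))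

∑-zero : ∀ (xs : List A) → ∑[ x ∈ xs ] 0 ≡ 0
∑-zero []       = refl
∑-zero (x ∷ xs) = ∑-zero xs

∑-if : ∀ b xs (f : A → ℕ) → ∑[ x ∈ xs ] (if b then f x else 0) ≡ (if b then ∑ xs f else 0)
∑-if true  xs f = refl
∑-if false xs f = ∑-zero xs

∑-upTo-suc : ∀ K (f : ℕ → ℕ) → ∑ (upTo (suc K)) f ≡ f 0 + ∑[ k ∈ upTo K ] f (suc k)
∑-upTo-suc K f = cong (λ xs → f 0 + sum xs)
  (trans (map-applyUpTo suc f K) (sym (map-applyUpTo (λ k → k) (f ∘ suc) K)))

∑-upTo-≡ᵇ : ∀ K a (f : ℕ → ℕ) →
  ∑[ k ∈ upTo K ] (if a ≡ᵇ k then f k else 0) ≡ (if a <ᵇ K then f a else 0)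
∑-upTo-≡ᵇ zero    a       f = refl
∑-upTo-≡ᵇ (suc K) zero    f =
  trans (∑-upTo-suc K (λ k → if 0 ≡ᵇ k then f k else 0))
        (trans (cong (f 0 +_) (∑-zero (upTo K))) (+-identityʳ (f 0)))
∑-upTo-≡ᵇ (suc K) (suc a) f =
  trans (∑-upTo-suc K (λ k → if suc a ≡ᵇ k then f k else 0)) (∑-upTo-≡ᵇ K a (f ∘ suc))

∑-upTo-≡ᵇ-< : ∀ {K a} (f : ℕ → ℕ) → a < K →
  ∑[ k ∈ upTo K ] (if a ≡ᵇ k then f k else 0) ≡ f a
∑-upTo-≡ᵇ-< {K} {a} f a<K = trans (∑-upTo-≡ᵇ K a f) (if-cong (Equivalence.to T-≡ (<⇒<ᵇ a<K)))

if-cong-T : ∀ b {x x′ : ℕ} → (T b → x ≡ x′) → (if b then x else 0) ≡ (if b then x′ else 0)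
if-cong-T true  x≡x′ = x≡x′ _
if-cong-T false _    = refl

count : (A → Bool) → List A → ℕ
count P xs = length (filterᵇ P xs)

count-as-∑ : ∀ (P : A → Bool) xs → count P xs ≡ ∑[ x ∈ xs ] (if P x then 1 else 0)
count-as-∑ P []       = refl
count-as-∑ P (x ∷ xs) with P x
... | true  = cong suc (count-as-∑ P xs)
... | false = count-as-∑ P xs

count-∧ : ∀ b (P : A → Bool) xs → count (λ x → b ∧ P x) xs ≡ (if b then count P xs else 0)
count-∧ true  P xs = refl
count-∧ false P xs = trans (count-as-∑ (λ _ → false) xs) (∑-zero xs)

count-seqs-suc : ∀ (P : List A → Bool) xs n →
  count P (seqs xs (suc n)) ≡ ∑[ x ∈ xs ] count (λ w → P (x ∷ w)) (seqs xs n)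
count-seqs-suc P xs n = begin
  count P (seqs xs (suc n))
    ≡⟨ count-as-∑ P (seqs xs (suc n)) ⟩
  ∑[ w ∈ seqs xs (suc n) ] (if P w then 1 else 0)
    ≡⟨ ∑-concatMap (λ x → map (x ∷_) (seqs xs n)) xs (λ w → if P w then 1 else 0) ⟩
  ∑[ x ∈ xs ] ∑[ w ∈ map (x ∷_) (seqs xs n) ] (if P w then 1 else 0)
    ≡⟨ ∑-cong xs (λ x → trans (∑-map (x ∷_) (seqs xs n) (λ w → if P w then 1 else 0))
                               (sym (count-as-∑ (λ w → P (x ∷ w)) (seqs xs n)))) ⟩
  ∑[ x ∈ xs ] count (λ w → P (x ∷ w)) (seqs xs n)
    ∎

paths : ℕ → ℕ → Prev → ℕ → ℕ
paths m y p n = count (validFrom m y p) (seqs allSteps n)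

walksFrom : ℕ → ℕ × ℕ → ℕ → ℕ
walksFrom m v n = count (walkFrom v) (seqs (vertices m) n)

below : (ℕ → ℕ) → ℕ → ℕ
below f zero    = 0
below f (suc y) = f y

paths-suc : ∀ m y p n → paths m y p (suc n) ≡
    (if y <ᵇ m then (if notRetract p N then paths m (suc y) (some N) n else 0) else 0)
  + (below (λ z → if notRetract p S then paths m z (some S) n else 0) y + paths m y (some E) n)
paths-suc m y p n =
  trans (count-seqs-suc (validFrom m y p) allSteps n)
        (cong₂ _+_ north-term (cong₂ _+_ (south-term y) (+-identityʳ (paths m y (some E) n))))
  where
  north-term : count (λ w → notRetract p N ∧ ((y <ᵇ m) ∧ validFrom m (suc y) (some N) w)) (seqs allSteps n)
             ≡ (if y <ᵇ m then (if notRetract p N then paths m (suc y) (some N) n else 0) else 0)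
  north-term = trans (count-∧ (notRetract p N) _ (seqs allSteps n))
                     (trans (if-cong-then (notRetract p N) (count-∧ (y <ᵇ m) _ (seqs allSteps n)))
                            (if-swap-then (notRetract p N) (y <ᵇ m)))
  south-term : ∀ y → count (λ w → validFrom m y p (S ∷ w)) (seqs allSteps n)
             ≡ below (λ z → if notRetract p S then paths m z (some S) n else 0) y
  south-term zero    = trans (count-as-∑ (λ _ → false) (seqs allSteps n)) (∑-zero (seqs allSteps n))
  south-term (suc z) = count-∧ (notRetract p S) (validFrom m z (some S)) (seqs allSteps n)

∑-vertices : ∀ m (f : ℕ × ℕ → ℕ) →
  ∑ (vertices m) f ≡ ∑[ i ∈ upTo (suc m) ] ∑[ k ∈ upTo (suc m) ] (if near i k then f (i , k) else 0)
∑-vertices m f =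
  trans (∑-filterᵇ _ grid f)
        (trans (∑-concatMap (λ i → map (i ,_) (upTo (suc m))) (upTo (suc m)) near-f)
               (∑-cong (upTo (suc m)) (λ i → ∑-map (i ,_) (upTo (suc m)) near-f)))
  where
  grid : List (ℕ × ℕ)
  grid = concatMap (λ i → map (i ,_) (upTo (suc m))) (upTo (suc m))
  near-f : ℕ × ℕ → ℕ
  near-f (i , k) = if near i k then f (i , k) else 0

-- edge (a , y) (i , k) unfolds to (y ≡ᵇ i) ∧ noUTurn a y k.
noUTurn : ℕ → ℕ → ℕ → Bool
noUTurn i j k = not (adjacent i j ∧ (k ≡ᵇ i))

∑-successors : ∀ m a y (f : ℕ × ℕ → ℕ) → y ≤ m →
    ∑[ u ∈ vertices m ] (if edge (a , y) u then f u else 0)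
  ≡ ∑[ k ∈ upTo (suc m) ] (if near y k then (if noUTurn a y k then f (y , k) else 0) else 0)
∑-successors m a y f y≤m = begin
  ∑[ u ∈ vertices m ] (if edge (a , y) u then f u else 0)
    ≡⟨ ∑-vertices m (λ u → if edge (a , y) u then f u else 0) ⟩
  ∑[ i ∈ U ] ∑[ k ∈ U ] (if near i k then (if (y ≡ᵇ i) ∧ noUTurn a y k then f (i , k) else 0) else 0)
    ≡⟨ ∑-cong U (λ i → trans (∑-cong U (λ k → pull-out-row i k)) (∑-if (y ≡ᵇ i) U _)) ⟩
  ∑[ i ∈ U ] (if y ≡ᵇ i then ∑[ k ∈ U ] row i k else 0)
    ≡⟨ ∑-upTo-≡ᵇ-< (λ i → ∑[ k ∈ U ] row i k) (s≤s y≤m) ⟩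
  ∑[ k ∈ U ] row y k
    ∎
  where
  U : List ℕ
  U = upTo (suc m)
  row : ℕ → ℕ → ℕ
  row i k = if near i k then (if noUTurn a y k then f (i , k) else 0) else 0
  pull-out-row : ∀ i k → (if near i k then (if (y ≡ᵇ i) ∧ noUTurn a y k then f (i , k) else 0) else 0)
                       ≡ (if y ≡ᵇ i then row i k else 0)
  pull-out-row i k = trans (if-cong-then (near i k) (if-∧ (y ≡ᵇ i))) (if-swap-then (near i k) (y ≡ᵇ i))

walksFrom-suc : ∀ m a y n → y ≤ m → walksFrom m (a , y) (suc n)
  ≡ ∑[ k ∈ upTo (suc m) ] (if near y k then (if noUTurn a y k then walksFrom m (y , k) n else 0) else 0)
walksFrom-suc m a y n y≤m =
  trans (count-seqs-suc (walkFrom (a , y)) (vertices m) n)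
        (trans (∑-cong (vertices m) (λ u → count-∧ (edge (a , y) u) (walkFrom u) (seqs (vertices m) n)))
               (∑-successors m a y (λ u → walksFrom m u n) y≤m))

if-near : ∀ y k x →
    (if near y k then x else 0)
  ≡ (if suc y ≡ᵇ k then x else 0) + ((if y ≡ᵇ suc k then x else 0) + (if y ≡ᵇ k then x else 0))
if-near zero          zero          x = refl
if-near zero          (suc zero)    x = sym (+-identityʳ x)
if-near zero          (suc (suc k)) x = refl
if-near (suc zero)    zero          x = cong (0 +_) (sym (+-identityʳ x))
if-near (suc (suc y)) zero          x = refl
if-near (suc y)       (suc k)       x = if-near y k x

∑-near : ∀ m y (f : ℕ → ℕ) → y ≤ m →
    ∑[ k ∈ upTo (suc m) ] (if near y k then f k else 0)
  ≡ (if y <ᵇ m then f (suc y) else 0) + (below f y + f y)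
∑-near m y f y≤m = begin
  ∑[ k ∈ U ] (if near y k then f k else 0)
    ≡⟨ ∑-cong U (λ k → if-near y k (f k)) ⟩
  ∑[ k ∈ U ] (up k + (down k + level k))
    ≡⟨ trans (∑-+ U up _) (cong (∑ U up +_) (∑-+ U down level)) ⟩
  ∑ U up + (∑ U down + ∑ U level)
    ≡⟨ cong₂ _+_ (∑-upTo-≡ᵇ (suc m) (suc y) f) (cong₂ _+_ (∑-below y≤m) (∑-upTo-≡ᵇ-< f (s≤s y≤m))) ⟩
  (if y <ᵇ m then f (suc y) else 0) + (below f y + f y)
    ∎
  where
  U : List ℕ
  U = upTo (suc m)
  up down level : ℕ → ℕ
  up    k = if suc y ≡ᵇ k then f k else 0
  down  k = if y ≡ᵇ suc k then f k else 0
  level k = if y ≡ᵇ k then f k else 0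
  ∑-below : ∀ {z} → z ≤ m → ∑[ k ∈ U ] (if z ≡ᵇ suc k then f k else 0) ≡ below f z
  ∑-below {zero}  _     = ∑-zero U
  ∑-below {suc z} sz≤m = ∑-upTo-≡ᵇ-< f (m≤n⇒m≤1+n sz≤m)

≡ᵇ-refl : ∀ n → (n ≡ᵇ n) ≡ true
≡ᵇ-refl n = dec-true (n ≟ n) refl

≢⇒≡ᵇ-false : ∀ {m n} → m ≢ n → (m ≡ᵇ n) ≡ false
≢⇒≡ᵇ-false {m} {n} = dec-false (m ≟ n)

adjacent-irrefl : ∀ y → adjacent y y ≡ false
adjacent-irrefl zero    = refl
adjacent-irrefl (suc y) = adjacent-irrefl y

adjacent-suc : ∀ y → adjacent y (suc y) ≡ true
adjacent-suc y = cong (_∨ (suc (suc y) ≡ᵇ y)) (≡ᵇ-refl y)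

adjacent-pred : ∀ y → adjacent (suc y) y ≡ true
adjacent-pred y = trans (cong ((suc (suc y) ≡ᵇ y) ∨_) (≡ᵇ-refl y)) (∨-zeroʳ (suc (suc y) ≡ᵇ y))

noUTurn-flat : ∀ y k → noUTurn y y k ≡ true
noUTurn-flat y k = cong (λ b → not (b ∧ (k ≡ᵇ y))) (adjacent-irrefl y)

noUTurn-≢ : ∀ {a y k} → k ≢ a → noUTurn a y k ≡ true
noUTurn-≢ {a} {y} k≢a =
  cong not (trans (cong (adjacent a y ∧_) (≢⇒≡ᵇ-false k≢a)) (∧-zeroʳ (adjacent a y)))

noUTurn-back : ∀ {a y} → adjacent a y ≡ true → noUTurn a y a ≡ false
noUTurn-back {a} adj = cong₂ (λ b c → not (b ∧ c)) adj (≡ᵇ-refl a)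

noUTurn-stay : ∀ a y → noUTurn a y y ≡ true
noUTurn-stay a y with y ≟ a
... | yes refl = noUTurn-flat y y
... | no  y≢a  = noUTurn-≢ y≢a

data LastStep : Prev → ℕ → ℕ → Set where
  start : ∀ {y} → LastStep none y y
  east  : ∀ {y} → LastStep (some E) y y
  north : ∀ {y} → LastStep (some N) y (suc y)
  south : ∀ {y} → LastStep (some S) (suc y) y

north-allowed : ∀ {p a y} → LastStep p a y → notRetract p N ≡ noUTurn a y (suc y)
north-allowed (start {y}) = sym (noUTurn-flat y (suc y))
north-allowed (east {y})  = sym (noUTurn-flat y (suc y))
north-allowed (north {y}) = sym (noUTurn-≢ {y} {suc y} (>⇒≢ (s≤s (n≤1+n y))))
north-allowed (south {y}) = sym (noUTurn-back {suc y} {y} (adjacent-pred y))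

south-allowed : ∀ {p a y} → LastStep p a (suc y) → notRetract p S ≡ noUTurn a (suc y) y
south-allowed {y = y} start = sym (noUTurn-flat (suc y) y)
south-allowed {y = y} east  = sym (noUTurn-flat (suc y) y)
south-allowed {y = y} north = sym (noUTurn-back {y} {suc y} (adjacent-suc y))
south-allowed {y = y} south = sym (noUTurn-≢ {suc (suc y)} {suc y} (<⇒≢ (s≤s (n≤1+n y))))

paths≡walksFrom : ∀ m n {p a y} → LastStep p a y → y ≤ m → paths m y p n ≡ walksFrom m (a , y) n
paths≡walksFrom m zero    r y≤m = refl
paths≡walksFrom m (suc n) {p} {a} {y} r y≤m = begin
  paths m y p (suc n)
    ≡⟨ paths-suc m y p n ⟩
    (if y <ᵇ m then (if notRetract p N then paths m (suc y) (some N) n else 0) else 0)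
  + (below (λ z → if notRetract p S then paths m z (some S) n else 0) y + paths m y (some E) n)
    ≡⟨ cong₂ _+_ north-term (cong₂ _+_ (south-term r y≤m) east-term) ⟩
  (if y <ᵇ m then G (suc y) else 0) + (below G y + G y)
    ≡⟨ sym (trans (walksFrom-suc m a y n y≤m) (∑-near m y G y≤m)) ⟩
  walksFrom m (a , y) (suc n)
    ∎
  where
  G : ℕ → ℕ
  G k = if noUTurn a y k then walksFrom m (y , k) n else 0
  north-term : (if y <ᵇ m then (if notRetract p N then paths m (suc y) (some N) n else 0) else 0)
             ≡ (if y <ᵇ m then G (suc y) else 0)
  north-term = if-cong-T (y <ᵇ m) (λ y<m →
    cong₂ (λ b x → if b then x else 0) (north-allowed r) (paths≡walksFrom m n north (<ᵇ⇒< y m y<m)))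
  south-term : ∀ {z} → LastStep p a z → z ≤ m →
      below (λ z′ → if notRetract p S then paths m z′ (some S) n else 0) z
    ≡ below (λ k → if noUTurn a z k then walksFrom m (z , k) n else 0) z
  south-term {zero}  _  _    = refl
  south-term {suc z} r′ sz≤m =
    cong₂ (λ b x → if b then x else 0) (south-allowed r′) (paths≡walksFrom m n south (<⇒≤ sz≤m))
  east-term : paths m y (some E) n ≡ G y
  east-term = trans (paths≡walksFrom m n east y≤m) (sym (if-cong (noUTurn-stay a y)))

lemma2p2 : (m n : ℕ) → m ≥ 1 → c m n ≡ walks m n
lemma2p2 m n _ = paths≡walksFrom m n start z≤n
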